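{- Let $\mathbf{A}$ be an $\mathbb{RL}^D$-algebra and let $a\in A$ be such that the set $\{b\in A: b\le a\}$ is finite. Then the greatest element $b\le a$ with $b\vee\neg b=1$ exists, and it equals $(\neg D)^n a$ for some $n\in\mathbb{N}$, where $(\neg D)^0a=a$ and $(\neg D)^{k+1}a=\neg D((\neg D)^k a)$.
   Context: A residuated lattice is an algebra $(A;\wedge,\vee,\cdot,\to,0,1)$ with $(A;\wedge,\vee,0,1)$ a bounded lattice ($0$ least, $1$ greatest), $(A;\cdot,1)$ a commutative monoid, and $a\cdot b\le c$ iff $a\le b\to c$; $\neg a=a\to0$. An $\mathbb{RL}^D$-algebra is a residuated lattice expanded with a unary operation $D$ such that, for every $a$, $Da$ is the least element $b$ with $a\vee b=1$. -}

module Defs where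

open import Level using (Level; suc; _⊔_)
open import Data.Nat using (ℕ; zero) renaming (suc to sucℕ)
open import Data.Product using (_×_; Σ; ∃; _,_)
open import Data.List using (List)
open import Data.List.Membership.Propositional using (_∈_)
open import Relation.Binary.PropositionalEquality using (_≡_)

-- Residuated lattice (bounded, commutative, integral: 1 is top), equality is ≡.
-- The lattice order is  x ≤ y  :=  x ∧ y ≡ x.
record ResiduatedLattice (c : Level) : Set (suc c) where
  infixr 6 _∨_
  infixr 7 _∧_
  infixr 8 _·_
  infixr 5 _⇒_
  field
    Carrier : Set c
    _∧_ _∨_ _·_ _⇒_ : Carrier → Carrier → Carrier
    𝟘 𝟙 : Carrier
    ∧-comm : ∀ x y → x ∧ y ≡ y ∧ x
    ∨-comm : ∀ x y → x ∨ y ≡ y ∨ x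
    ∧-assoc : ∀ x y z → (x ∧ y) ∧ z ≡ x ∧ (y ∧ z)
    ∨-assoc : ∀ x y z → (x ∨ y) ∨ z ≡ x ∨ (y ∨ z)
    ∧-absorbs-∨ : ∀ x y → x ∧ (x ∨ y) ≡ x
    ∨-absorbs-∧ : ∀ x y → x ∨ (x ∧ y) ≡ x
    𝟘-least : ∀ x → 𝟘 ∧ x ≡ 𝟘
    𝟙-greatest : ∀ x → x ∧ 𝟙 ≡ x
    ·-comm : ∀ x y → x · y ≡ y · x
    ·-assoc : ∀ x y z → (x · y) · z ≡ x · (y · z)
    ·-identityˡ : ∀ x → 𝟙 · x ≡ x
    residuation→ : ∀ x y z → (x · y) ∧ z ≡ x · y → x ∧ (y ⇒ z) ≡ x
    residuation← : ∀ x y z → x ∧ (y ⇒ z) ≡ x → (x · y) ∧ z ≡ x · y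

  infix 4 _≤_
  _≤_ : Carrier → Carrier → Set c
  x ≤ y = x ∧ y ≡ x

  ¬_ : Carrier → Carrier
  ¬ x = x ⇒ 𝟘

record RLD (c : Level) : Set (suc c) where
  field
    rl : ResiduatedLattice c
  open ResiduatedLattice rl public
  field
    D : Carrier → Carrier
    D-complements : ∀ x → x ∨ D x ≡ 𝟙
    D-least : ∀ x y → x ∨ y ≡ 𝟙 → D x ≤ y

  ¬D^ : ℕ → Carrier → Carrier
  ¬D^ zero x = x
  ¬D^ (sucℕ n) x = ¬ (D (¬D^ n x))

  DownsetFinite : Carrier → Set c
  DownsetFinite a = Σ (List Carrier) λ xs → ∀ b → b ≤ a → b ∈ xs

  Complemented : Carrier → Set c
  Complemented b = b ∨ (¬ b) ≡ 𝟙

-- (¬D)ᵏ a is a decreasing chain below a (since ¬Dx ≤ x), and every complemented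
-- b ≤ a stays below each of its terms (since x ∨ ¬b = 1 forces Dx ≤ ¬b). As the
-- down-set of a is finite, the chain repeats, so it reaches a fixed point of ¬D;
-- a fixed point x of ¬D is complemented, because Dx ≤ ¬¬Dx = ¬x and x ∨ Dx = 1.
module Submission where

open import Defs
open import Level using (Level)
open import Data.Nat using (ℕ)
open import Data.Product using (Σ; _×_)

import Data.Nat as ℕ
open import Data.Nat.Properties using (≤⇒≤′; n<1+n)
open import Data.Product using (_,_; ∃₂)
open import Data.List using (List; length; lookup)
open import Data.List.Membership.Propositional using (_∈_)
open import Data.List.Relation.Unary.Any using (index)
open import Data.List.Relation.Unary.Any.Properties using (lookup-index)
open import Data.Fin using (toℕ)
open import Data.Fin.Properties using (pigeonhole)
open import Relation.Binary.PropositionalEquality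

sequence-in-list-repeats : ∀ {a} {X : Set a} (f : ℕ → X) (xs : List X) →
  (∀ n → f n ∈ xs) → ∃₂ λ i j → i ℕ.< j × f i ≡ f j
sequence-in-list-repeats f xs f∈xs
  with i , j , i<j , same-index ← pigeonhole (n<1+n (length xs)) (λ k → index (f∈xs (toℕ k)))
  = toℕ i , toℕ j , i<j , (begin
      f (toℕ i)                        ≡⟨ lookup-index (f∈xs (toℕ i)) ⟩
      lookup xs (index (f∈xs (toℕ i))) ≡⟨ cong (lookup xs) same-index ⟩
      lookup xs (index (f∈xs (toℕ j))) ≡⟨ lookup-index (f∈xs (toℕ j)) ⟨
      f (toℕ j)                        ∎)
  where open ≡-Reasoning

module ResiduatedLatticeProperties {c : Level} (L : ResiduatedLattice c) where
  open ResiduatedLattice L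

  ≤-refl : ∀ x → x ≤ x
  ≤-refl x = trans (cong (x ∧_) (sym (∨-absorbs-∧ x x))) (∧-absorbs-∨ x (x ∧ x))

  ≤-trans : ∀ {x y z} → x ≤ y → y ≤ z → x ≤ z
  ≤-trans {x} {y} {z} x≤y y≤z = begin
    x ∧ z       ≡⟨ cong (_∧ z) x≤y ⟨
    (x ∧ y) ∧ z ≡⟨ ∧-assoc x y z ⟩
    x ∧ (y ∧ z) ≡⟨ cong (x ∧_) y≤z ⟩
    x ∧ y       ≡⟨ x≤y ⟩
    x           ∎
    where open ≡-Reasoning

  ≤-antisym : ∀ {x y} → x ≤ y → y ≤ x → x ≡ y
  ≤-antisym {x} {y} x≤y y≤x = trans (sym x≤y) (trans (∧-comm x y) y≤x)

  ≤⇒∨≡ : ∀ {x y} → x ≤ y → x ∨ y ≡ y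
  ≤⇒∨≡ {x} {y} x≤y = begin
    x ∨ y       ≡⟨ cong (_∨ y) x≤y ⟨
    (x ∧ y) ∨ y ≡⟨ ∨-comm (x ∧ y) y ⟩
    y ∨ (x ∧ y) ≡⟨ cong (y ∨_) (∧-comm x y) ⟩
    y ∨ (y ∧ x) ≡⟨ ∨-absorbs-∧ y x ⟩
    y           ∎
    where open ≡-Reasoning

  ∨≡⇒≤ : ∀ {x y} → x ∨ y ≡ y → x ≤ y
  ∨≡⇒≤ {x} {y} x∨y≡y = trans (cong (x ∧_) (sym x∨y≡y)) (∧-absorbs-∨ x y)

  x≤x∨y : ∀ x y → x ≤ x ∨ y
  x≤x∨y = ∧-absorbs-∨

  y≤x∨y : ∀ x y → y ≤ x ∨ y
  y≤x∨y x y = subst (y ≤_) (∨-comm y x) (x≤x∨y y x)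

  ∨-lub : ∀ {x y z} → x ≤ z → y ≤ z → x ∨ y ≤ z
  ∨-lub {x} {y} {z} x≤z y≤z =
    ∨≡⇒≤ (trans (∨-assoc x y z) (trans (cong (x ∨_) (≤⇒∨≡ y≤z)) (≤⇒∨≡ x≤z)))

  𝟙≤⇒≡𝟙 : ∀ {x} → 𝟙 ≤ x → x ≡ 𝟙
  𝟙≤⇒≡𝟙 {x} 𝟙≤x = trans (sym (𝟙-greatest x)) (trans (∧-comm x 𝟙) 𝟙≤x)

  ∨≡𝟙-monoʳ : ∀ {x y z} → y ≤ z → x ∨ y ≡ 𝟙 → x ∨ z ≡ 𝟙
  ∨≡𝟙-monoʳ {x} {y} {z} y≤z x∨y≡𝟙 =
    𝟙≤⇒≡𝟙 (subst (_≤ x ∨ z) x∨y≡𝟙 (∨-lub (x≤x∨y x z) (≤-trans y≤z (y≤x∨y x z))))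

  ∨≡𝟙-monoˡ : ∀ {x y z} → x ≤ y → x ∨ z ≡ 𝟙 → y ∨ z ≡ 𝟙
  ∨≡𝟙-monoˡ {x} {y} {z} x≤y x∨z≡𝟙 =
    trans (∨-comm y z) (∨≡𝟙-monoʳ x≤y (trans (∨-comm z x) x∨z≡𝟙))

  ·≤⇒≤⇒ : ∀ {x y z} → x · y ≤ z → x ≤ y ⇒ z
  ·≤⇒≤⇒ {x} {y} {z} = residuation→ x y z

  ≤⇒⇒·≤ : ∀ {x y z} → x ≤ y ⇒ z → x · y ≤ z
  ≤⇒⇒·≤ {x} {y} {z} = residuation← x y z

  ·-monoˡ-≤ : ∀ {x y} z → x ≤ y → x · z ≤ y · z
  ·-monoˡ-≤ {y = y} z x≤y = ≤⇒⇒·≤ (≤-trans x≤y (·≤⇒≤⇒ (≤-refl (y · z))))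

  x·y≤x : ∀ x y → x · y ≤ x
  x·y≤x x y = subst₂ _≤_ (·-comm y x) (·-identityˡ x) (·-monoˡ-≤ x (𝟙-greatest y))

  ¬x·x≤𝟘 : ∀ x → (¬ x) · x ≤ 𝟘
  ¬x·x≤𝟘 x = ≤⇒⇒·≤ (≤-refl (¬ x))

  x·¬x≤𝟘 : ∀ x → x · (¬ x) ≤ 𝟘
  x·¬x≤𝟘 x = subst (_≤ 𝟘) (·-comm (¬ x) x) (¬x·x≤𝟘 x)

  x≤¬¬x : ∀ x → x ≤ ¬ ¬ x
  x≤¬¬x x = ·≤⇒≤⇒ (x·¬x≤𝟘 x)

module RLDProperties {c : Level} (A : RLD c) where
  open RLD A
  open ResiduatedLatticeProperties rl

  ¬D-deflationary : ∀ x → ¬ D x ≤ x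
  ¬D-deflationary x = subst (_≤ x) (·-identityˡ (¬ D x)) (≤⇒⇒·≤ 𝟙≤¬Dx⇒x)
    where
    𝟙≤¬Dx⇒x : 𝟙 ≤ ¬ D x ⇒ x
    𝟙≤¬Dx⇒x = subst (_≤ ¬ D x ⇒ x) (D-complements x)
      (∨-lub (·≤⇒≤⇒ (x·y≤x x (¬ D x)))
             (·≤⇒≤⇒ (≤-trans (x·¬x≤𝟘 (D x)) (𝟘-least x))))

  complemented-≤⇒≤¬D : ∀ {b x} → b ≤ x → Complemented b → b ≤ ¬ D x
  complemented-≤⇒≤¬D {b} {x} b≤x b∨¬b≡𝟙 =
    ·≤⇒≤⇒ (≤-trans (subst (_≤ (¬ b) · b) (·-comm (D x) b) (·-monoˡ-≤ b Dx≤¬b)) (¬x·x≤𝟘 b))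
    where
    Dx≤¬b : D x ≤ ¬ b
    Dx≤¬b = D-least x (¬ b) (∨≡𝟙-monoˡ b≤x b∨¬b≡𝟙)

  ¬D-fixed⇒complemented : ∀ {x} → ¬ D x ≡ x → Complemented x
  ¬D-fixed⇒complemented {x} ¬Dx≡x = ∨≡𝟙-monoʳ Dx≤¬x (D-complements x)
    where
    Dx≤¬x : D x ≤ ¬ x
    Dx≤¬x = subst (λ w → D x ≤ ¬ w) ¬Dx≡x (x≤¬¬x (D x))

  ¬D^-antitone : ∀ a {m n} → m ℕ.≤ n → ¬D^ n a ≤ ¬D^ m a
  ¬D^-antitone a m≤n = go (≤⇒≤′ m≤n)
    where
    go : ∀ {m n} → m ℕ.≤′ n → ¬D^ n a ≤ ¬D^ m a
    go ℕ.≤′-refl        = ≤-refl _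
    go (ℕ.≤′-step m≤′n) = ≤-trans (¬D-deflationary _) (go m≤′n)

  ¬D^-≤ : ∀ a n → ¬D^ n a ≤ a
  ¬D^-≤ a n = ¬D^-antitone a {n = n} ℕ.z≤n

  complemented-≤⇒≤¬D^ : ∀ {a b} → b ≤ a → Complemented b → ∀ n → b ≤ ¬D^ n a
  complemented-≤⇒≤¬D^ b≤a cb ℕ.zero    = b≤a
  complemented-≤⇒≤¬D^ b≤a cb (ℕ.suc n) = complemented-≤⇒≤¬D (complemented-≤⇒≤¬D^ b≤a cb n) cb

  -- If the chain repeats at i < j, it is constant on [i, j], in particular at i and i + 1.
  ¬D^-stabilises : ∀ a → DownsetFinite a → Σ ℕ λ n → ¬ D (¬D^ n a) ≡ ¬D^ n a
  ¬D^-stabilises a (xs , ↓a⊆xs)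
    with i , j , i<j , ¬D^ia≡¬D^ja ← sequence-in-list-repeats (λ n → ¬D^ n a) xs (λ n → ↓a⊆xs _ (¬D^-≤ a n))
    = i , ≤-antisym (¬D-deflationary _)
            (subst (_≤ ¬D^ (ℕ.suc i) a) (sym ¬D^ia≡¬D^ja) (¬D^-antitone a i<j))

proposition20 : ∀ {c : Level} (A : RLD c) (a : RLD.Carrier A) →
    RLD.DownsetFinite A a →
    Σ ℕ (λ n →
      (RLD._≤_ A (RLD.¬D^ A n a) a
        × RLD.Complemented A (RLD.¬D^ A n a))
      × (∀ b → RLD._≤_ A b a → RLD.Complemented A b → RLD._≤_ A b (RLD.¬D^ A n a)))
proposition20 A a ↓a-finite =
  let n , fixed = ¬D^-stabilises a ↓a-finite in
  n , (¬D^-≤ a n , ¬D-fixed⇒complemented fixed) , λ b b≤a cb → complemented-≤⇒≤¬D^ b≤a cb n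
  where open RLDProperties A
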